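{- Let $n\ge2$, let $0\le\alpha_1<\dots<\alpha_n$ be integers, let $1\le k<n$, and let $(p,q)$ be an index pair of the table $L_k$. Consider the reconstruction variant of the net-building algorithm (described in the context) on input $D=\{\alpha_1,\dots,\alpha_n\}$, after its outer loop has completed its $k$-th iteration. Then the cell $L_k(p,q)$ is nonempty if and only if there exists a sequence $(x_1,\dots,x_k)$ of positive integers with $\sum_{i=1}^k x_i=p$ and $\sum_{i=1}^k\alpha_i x_i=q$ such that, writing $p_i=\sum_{j\le i}x_j$, $q_i=\sum_{j\le i}\alpha_jx_j$ ($p_0=q_0=0$), for every $i\in\{1,\dots,k\}$ one has $q_{i-1}-p_{i-1}(p_{i-1}-1)/2\ge0$ and $1\le x_i\le\frac{h_i+\sqrt{h_i^2+8(q_{i-1}-p_{i-1}(p_{i-1}-1)/2)}}{2}$ with $h_i=2(\alpha_i-p_{i-1})+1$.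
   Context: Reconstruction variant of the net-building algorithm: set $\alpha_0=0$. For $k=0,\dots,n$ there is a table $L_k$ with cells indexed by integer pairs $(p,q)$, $0\le p\le 2\alpha_k+1$, $0\le q\le(2\alpha_k+1)\alpha_k$; each cell is a set of triples $(p',q',x)$, initially empty except $L_0(0,0)=\{(0,0,0)\}$. Let $B(p',q',a)=\frac{h+\sqrt{h^2+8(q'-p'(p'-1)/2)}}{2}$ with $h=2(a-p')+1$. Outer loop: for $\ell=1,\dots,n-1$, for each integer $x$ with $1\le x\le 2\alpha_\ell+1$, for each $(p',q')$ with $0\le p'\le 2\alpha_{\ell-1}+1$, $0\le q'\le(2\alpha_{\ell-1}+1)\alpha_{\ell-1}$ and $L_{\ell-1}(p',q')\ne\emptyset$: if $x\le B(p',q',\alpha_\ell)$ and the cell $L_\ell(p'+x,q'+x\alpha_\ell)$ is currently empty, insert $(p',q',x)$ into it. -}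

module Defs where

open import Data.Nat as ℕ using (ℕ; zero; suc; _∸_)
open import Data.Integer as ℤ using (ℤ; +_)
open import Data.Fin as Fin using (Fin)
open import Data.Bool using (Bool; true; false; if_then_else_; _∧_)
open import Data.List using (List; []; _∷_; foldl; upTo; map; null)
open import Data.Product using (_×_; _,_)
open import Data.Sum using (_⊎_)
open import Relation.Nullary using (Dec; does)
open import Relation.Nullary.Decidable using (_×-dec_; _⊎-dec_)

-- The input: α : Fin n → ℕ encodes α₁ < … < αₙ (α (i-1) = αᵢ).
-- αAt n α i = αᵢ for 1 ≤ i ≤ n, and αAt n α 0 = α₀ = 0
-- (values outside 0..n are never used).

αAt : (n : ℕ) → (Fin n → ℕ) → ℕ → ℕ
αAt n α zero    = 0
αAt n α (suc i) with i ℕ.<? n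
... | Relation.Nullary.yes i<n = α (Fin.fromℕ< i<n)
... | Relation.Nullary.no  _   = 0

-- Arithmetic around the bound B(p',q',a) = (h + √(h² + 8 D)) / 2,
-- h = 2(a - p') + 1,  D = q' - p'(p'-1)/2.

-- twoD p' q' = 2·D = 2q' - p'(p'-1)   (an integer, p'(p'-1) is even)
twoD : ℕ → ℕ → ℤ
twoD p' q' = (+ (2 ℕ.* q')) ℤ.- (+ (p' ℕ.* (p' ∸ 1)))

hVal : ℕ → ℕ → ℤ
hVal a p' = ((+ 2) ℤ.* ((+ a) ℤ.- (+ p'))) ℤ.+ (+ 1)

radicand : ℕ → ℕ → ℕ → ℤ
radicand a p' q' = (hVal a p' ℤ.* hVal a p') ℤ.+ ((+ 4) ℤ.* twoD p' q')

-- "x ≤ B(p',q',a)" as a statement about real numbers, written out exactly: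
-- the square root must exist (radicand ≥ 0), and
--   x ≤ (h + √R)/2  ⇔  2x - h ≤ √R  ⇔  2x - h ≤ 0  ∨  (2x - h)² ≤ R.
LeB : ℕ → ℕ → ℕ → ℕ → Set
LeB p' q' a x =
  ((+ 0) ℤ.≤ radicand a p' q')
  × ((t ℤ.≤ (+ 0)) ⊎ ((t ℤ.* t) ℤ.≤ radicand a p' q'))
  where t = ((+ 2) ℤ.* (+ x)) ℤ.- hVal a p'

LeB? : ∀ p' q' a x → Dec (LeB p' q' a x)
LeB? p' q' a x =
  ((+ 0) ℤ.≤? radicand a p' q')
  ×-dec ((t ℤ.≤? (+ 0)) ⊎-dec ((t ℤ.* t) ℤ.≤? radicand a p' q'))
  where t = ((+ 2) ℤ.* (+ x)) ℤ.- hVal a p'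

Triple : Set
Triple = ℕ × ℕ × ℕ

Table : Set
Table = ℕ → ℕ → List Triple

emptyTable : Table
emptyTable _ _ = []

L0 : Table
L0 p q = if (p ℕ.≡ᵇ 0) ∧ (q ℕ.≡ᵇ 0) then (0 , 0 , 0) ∷ [] else []

insertIfEmpty : ℕ → ℕ → Triple → Table → Table
insertIfEmpty p q tr t a b =
  if (a ℕ.≡ᵇ p) ∧ (b ℕ.≡ᵇ q) ∧ null (t a b) then tr ∷ [] else t a b

range0 : ℕ → List ℕ
range0 m = upTo (suc m)

range1 : ℕ → List ℕ
range1 m = map suc (upTo m)

-- Iteration ℓ of the outer loop: aPrev = α_{ℓ-1}, a = α_ℓ,
-- prev = L_{ℓ-1}, cur = current state of L_ℓ.
-- for x = 1..2a+1, for p' = 0..2aPrev+1, for q' = 0..(2aPrev+1)aPrev: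
--   if L_{ℓ-1}(p',q') ≠ ∅ and x ≤ B(p',q',a) and L_ℓ(p'+x,q'+xa) = ∅,
--   insert (p',q',x) into L_ℓ(p'+x,q'+xa).
innerStep : ℕ → Table → ℕ → ℕ → ℕ → Table → Table
innerStep a prev x p' q' cur =
  if (Data.Bool.not (null (prev p' q'))) ∧ does (LeB? p' q' a x)
  then insertIfEmpty (p' ℕ.+ x) (q' ℕ.+ x ℕ.* a) (p' , q' , x) cur
  else cur

iteration : (aPrev a : ℕ) → Table → Table
iteration aPrev a prev =
  foldl (λ cur x →
    foldl (λ cur₁ p' →
      foldl (λ cur₂ q' → innerStep a prev x p' q' cur₂)
            cur₁ (range0 ((2 ℕ.* aPrev ℕ.+ 1) ℕ.* aPrev)))
      cur (range0 (2 ℕ.* aPrev ℕ.+ 1)))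
    emptyTable (range1 (2 ℕ.* a ℕ.+ 1))

-- table L n α k : the table L_k once the outer loop has completed its
-- k-th iteration (iteration ℓ only writes L_ℓ and only reads L_{ℓ-1},
-- so L_k is final after iteration k).
L : (n : ℕ) → (Fin n → ℕ) → ℕ → Table
L n α zero    = L0
L n α (suc ℓ) = iteration (αAt n α ℓ) (αAt n α (suc ℓ)) (L n α ℓ)

-- Prefix sums of a sequence x₁, x₂, … (given as x : ℕ → ℕ, x i = xᵢ).

P : (ℕ → ℕ) → ℕ → ℕ
P x zero    = 0
P x (suc i) = P x i ℕ.+ x (suc i)

Q : (ℕ → ℕ) → (ℕ → ℕ) → ℕ → ℕ
Q a x zero    = 0
Q a x (suc i) = Q a x i ℕ.+ a (suc i) ℕ.* x (suc i)

{-# OPTIONS --safe #-}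
module Submission where

-- Write 2D(p, q) = 2q − p(p − 1) and h = 2(a − p) + 1. A step (p, q) ↦ (p + x, q + a·x)
-- adds x(h − x) to 2D, and with e = 2x − h one gets h² + 8D − e² = 4 · 2D(p + x, q + a·x).
-- So a step with x ≤ B(p, q, a), i.e. e ≤ 0 or e² ≤ h² + 8D, keeps D ≥ 0. Along a sequence
-- with nondecreasing α we also have q ≤ α_k p, and with D ≥ 0 this forces p ≤ 2α_k + 1 and
-- q ≤ (2α_k + 1)α_k: every reachable cell, and the step that reaches it, lies inside the loop
-- ranges of the algorithm. Induction on k then matches the cells filled in L_k with the ends of
-- admissible sequences: a witness for L_{k−1} is extended by the step that filled the cell, and
-- conversely the last step of a sequence fills its end cell from the cell before it.

open import Defs
open import Data.Nat using (ℕ; zero; suc; _+_; _*_; _∸_; _≤_; _<_; z≤n; s≤s; _≤?_; _<?_; _≡ᵇ_)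
open import Data.Nat.Properties
  using ( ≡ᵇ⇒≡; ≡⇒≡ᵇ; ≤-refl; ≤-trans; <⇒≤; n<1+n; n≮n; m≤n+m; m<1+n⇒m<n∨m≡n
        ; n≤1+n; m<n⇒m<1+n; <-trans
        ; +-comm; *-comm; *-assoc; *-distribˡ-+; +-monoˡ-≤; *-monoˡ-≤; *-monoʳ-≤; *-cancelˡ-≤
        ; module ≤-Reasoning )
open import Data.Integer as ℤ using (+_; 0ℤ; -[1+_]; +≤+)
open import Data.Integer.Properties
  using (pos-+; pos-*; neg-mono-≤; i≤j⇒0≤j-i; 0≤i-j⇒j≤i; drop‿+≤+)
  renaming (+-mono-≤ to +-mono-≤ℤ)
open import Data.Integer.Tactic.RingSolver using (solve-∀)
open import Data.Fin using (Fin; fromℕ<)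
open import Data.Fin.Properties using (toℕ-fromℕ<)
open import Data.Bool using (Bool; true; false; _∧_; not; T; if_then_else_)
open import Data.List using (List; []; _∷_; foldl; null)
open import Data.List.Membership.Propositional using (_∈_)
open import Data.List.Membership.Propositional.Properties using (∈-map⁺; ∈-upTo⁺)
open import Data.List.Relation.Unary.Any using (Any; here; there; satisfied)
open import Data.List.Relation.Unary.Any.Properties using (map⁻)
open import Data.Product using (Σ; ∃; ∃-syntax; _×_; _,_; proj₁; proj₂)
open import Data.Sum using (_⊎_; inj₁; inj₂)
open import Relation.Nullary using (Dec; yes; no; does; contradiction)
open import Relation.Binary.PropositionalEquality
open import Function.Bundles using (_⇔_; mk⇔)

Stable : {S A : Set} → (S → Set) → (S → A → S) → Set
Stable R f = ∀ {s} y → R s → R (f s y)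

module _ {S A : Set} (R : S → Set) {f : S → A → S} (stable : Stable R f) where

  foldl-stable : ∀ ys {s} → R s → R (foldl f s ys)
  foldl-stable []       r = r
  foldl-stable (y ∷ ys) r = foldl-stable ys (stable y r)

  foldl-establishes : ∀ {y ys} → y ∈ ys → (∀ s → R (f s y)) → ∀ s → R (foldl f s ys)
  foldl-establishes {ys = _ ∷ ys} (here refl)  hit s = foldl-stable ys (hit s)
  foldl-establishes {ys = _ ∷ _}  (there y∈ys) hit s = foldl-establishes y∈ys hit (f s _)

foldl-traces : {S A : Set} (R : S → Set) (f : S → A → S) {C : A → Set}
             → (∀ s y → R (f s y) → R s ⊎ C y)
             → ∀ ys {s} → R (foldl f s ys) → R s ⊎ Any C ys
foldl-traces R f back []       r = inj₁ r
foldl-traces R f back (y ∷ ys) r with foldl-traces R f back ys r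
... | inj₂ c = inj₂ (there c)
... | inj₁ r′ with back _ y r′
...   | inj₁ r″ = inj₁ r″
...   | inj₂ c  = inj₂ (here c)

Occupied : Table → ℕ → ℕ → Set
Occupied t c d = t c d ≢ []

module _ (p q : ℕ) (tr : Triple) (t : Table) where

  insertIfEmpty-stable : ∀ {c d} → Occupied t c d → Occupied (insertIfEmpty p q tr t) c d
  insertIfEmpty-stable {c} {d} occ with (c ≡ᵇ p) ∧ (d ≡ᵇ q) ∧ null (t c d)
  ... | true  = λ ()
  ... | false = occ

  insertIfEmpty-occupies : Occupied (insertIfEmpty p q tr t) p q
  insertIfEmpty-occupies with p ≡ᵇ p | ≡⇒≡ᵇ p p refl | q ≡ᵇ q | ≡⇒≡ᵇ q q refl | t p q
  ... | true | _ | true | _ | []    = λ ()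
  ... | true | _ | true | _ | _ ∷ _ = λ ()

  insertIfEmpty⁻ : ∀ {c d} → Occupied (insertIfEmpty p q tr t) c d
                 → Occupied t c d ⊎ (c ≡ p × d ≡ q)
  insertIfEmpty⁻ {c} {d} occ with c ≡ᵇ p | ≡ᵇ⇒≡ c p | d ≡ᵇ q | ≡ᵇ⇒≡ d q
  ... | false | _   | _     | _   = inj₁ occ
  ... | true  | _   | false | _   = inj₁ occ
  ... | true  | c≡p | true  | d≡q = inj₂ (c≡p _ , d≡q _)

  insertIf-stable : ∀ b {c d} → Occupied t c d
                  → Occupied (if b then insertIfEmpty p q tr t else t) c d
  insertIf-stable true  occ = insertIfEmpty-stable occ
  insertIf-stable false occ = occ

  insertIf-occupies : ∀ b → T b → Occupied (if b then insertIfEmpty p q tr t else t) p q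
  insertIf-occupies true _ = insertIfEmpty-occupies

  insertIf⁻ : ∀ b {c d} → Occupied (if b then insertIfEmpty p q tr t else t) c d
            → Occupied t c d ⊎ (T b × c ≡ p × d ≡ q)
  insertIf⁻ false occ = inj₁ occ
  insertIf⁻ true  occ with insertIfEmpty⁻ occ
  ... | inj₁ occ′        = inj₁ occ′
  ... | inj₂ (c≡p , d≡q) = inj₂ (_ , c≡p , d≡q)

T-¬null∧does⁺ : ∀ {A : Set} (xs : List Triple) (A? : Dec A) → xs ≢ [] → A
              → T (not (null xs) ∧ does A?)
T-¬null∧does⁺ []      _       xs≢[] _ = contradiction refl xs≢[]
T-¬null∧does⁺ (_ ∷ _) (yes _) _     _ = _
T-¬null∧does⁺ (_ ∷ _) (no ¬a) _     a = contradiction a ¬a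

T-¬null∧does⁻ : ∀ {A : Set} (xs : List Triple) (A? : Dec A) → T (not (null xs) ∧ does A?)
              → xs ≢ [] × A
T-¬null∧does⁻ (_ ∷ _) (yes a) _ = (λ ()) , a

Candidate : Table → ℕ → Triple → ℕ → ℕ → Set
Candidate prev a (p′ , q′ , x) c d =
  Occupied prev p′ q′ × LeB p′ q′ a x × c ≡ p′ + x × d ≡ q′ + x * a

module Iteration (aPrev a : ℕ) (prev : Table) where

  qRange pRange xRange : List ℕ
  qRange = range0 ((2 * aPrev + 1) * aPrev)
  pRange = range0 (2 * aPrev + 1)
  xRange = range1 (2 * a + 1)

  guard : ℕ → ℕ → ℕ → Bool
  guard x p′ q′ = not (null (prev p′ q′)) ∧ does (LeB? p′ q′ a x)

  qStep : ℕ → ℕ → Table → ℕ → Table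
  qStep x p′ cur q′ = innerStep a prev x p′ q′ cur

  pStep : ℕ → Table → ℕ → Table
  pStep x cur p′ = foldl (qStep x p′) cur qRange

  xStep : Table → ℕ → Table
  xStep cur x = foldl (pStep x) cur pRange

  qStep-occupies : ∀ {x p′ q′} → Occupied prev p′ q′ → LeB p′ q′ a x
                 → ∀ cur → Occupied (qStep x p′ cur q′) (p′ + x) (q′ + x * a)
  qStep-occupies {x} {p′} {q′} occ lb cur =
    insertIf-occupies (p′ + x) (q′ + x * a) (p′ , q′ , x) cur (guard x p′ q′)
      (T-¬null∧does⁺ (prev p′ q′) (LeB? p′ q′ a x) occ lb)

  module _ {c d : ℕ} where

    private
      Occ : Table → Set
      Occ t = Occupied t c d

    qStep-stable : ∀ x p′ → Stable Occ (qStep x p′)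
    qStep-stable x p′ {cur} q′ =
      insertIf-stable (p′ + x) (q′ + x * a) (p′ , q′ , x) cur (guard x p′ q′)

    pStep-stable : ∀ x → Stable Occ (pStep x)
    pStep-stable x p′ = foldl-stable Occ (qStep-stable x p′) qRange

    xStep-stable : Stable Occ xStep
    xStep-stable x = foldl-stable Occ (pStep-stable x) pRange

    qStep⁻ : ∀ x p′ cur q′ → Occupied (qStep x p′ cur q′) c d
           → Occupied cur c d ⊎ Candidate prev a (p′ , q′ , x) c d
    qStep⁻ x p′ cur q′ occ
      with insertIf⁻ (p′ + x) (q′ + x * a) (p′ , q′ , x) cur (guard x p′ q′) occ
    ... | inj₁ occ′           = inj₁ occ′
    ... | inj₂ (g , c≡ , d≡) =
      let occ′ , lb = T-¬null∧does⁻ (prev p′ q′) (LeB? p′ q′ a x) g in inj₂ (occ′ , lb , c≡ , d≡)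

    pStep⁻ : ∀ x cur p′ → Occupied (pStep x cur p′) c d
           → Occupied cur c d ⊎ Any (λ q′ → Candidate prev a (p′ , q′ , x) c d) qRange
    pStep⁻ x cur p′ = foldl-traces _ (qStep x p′) (qStep⁻ x p′) qRange

    xStep⁻ : ∀ cur x → Occupied (xStep cur x) c d
           → Occupied cur c d ⊎ Any (λ p′ → Any (λ q′ → Candidate prev a (p′ , q′ , x) c d) qRange) pRange
    xStep⁻ cur x = foldl-traces _ (pStep x) (pStep⁻ x) pRange

  iteration-occupies : ∀ {x p′ q′} → 1 ≤ x → x ≤ 2 * a + 1
                     → p′ ≤ 2 * aPrev + 1 → q′ ≤ (2 * aPrev + 1) * aPrev
                     → Occupied prev p′ q′ → LeB p′ q′ a x
                     → Occupied (iteration aPrev a prev) (p′ + x) (q′ + x * a)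
  iteration-occupies {x@(suc _)} {p′} {q′} _ x≤ p′≤ q′≤ occ lb =
    foldl-establishes Occ xStep-stable (∈-map⁺ suc (∈-upTo⁺ x≤)) (λ _ →
      foldl-establishes Occ (pStep-stable _) (∈-upTo⁺ (s≤s p′≤)) (λ _ →
        foldl-establishes Occ (qStep-stable _ _) (∈-upTo⁺ (s≤s q′≤)) (qStep-occupies occ lb) _) _) emptyTable
    where
    Occ : Table → Set
    Occ t = Occupied t (p′ + x) (q′ + x * a)

  iteration⁻ : ∀ {c d} → Occupied (iteration aPrev a prev) c d
             → ∃[ p′ ] ∃[ q′ ] ∃[ x ] (1 ≤ x × Candidate prev a (p′ , q′ , x) c d)
  iteration⁻ occ with foldl-traces _ xStep xStep⁻ xRange occ
  ... | inj₁ occ∅ = contradiction refl occ∅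
  ... | inj₂ found with satisfied (map⁻ found)
  ...   | x , foundP with satisfied foundP
  ...     | p′ , foundQ with satisfied foundQ
  ...       | q′ , cand = p′ , q′ , suc x , s≤s z≤n , cand

open Iteration using (iteration-occupies; iteration⁻)

p*[p∸1]≡p*p-p : ∀ p → + (p * (p ∸ 1)) ≡ + p ℤ.* + p ℤ.- + p
p*[p∸1]≡p*p-p zero    = refl
p*[p∸1]≡p*p-p (suc m) = trans (pos-* (suc m) m) (identity (+ m))
  where
  identity : ∀ m → (+ 1 ℤ.+ m) ℤ.* m ≡ (+ 1 ℤ.+ m) ℤ.* (+ 1 ℤ.+ m) ℤ.- (+ 1 ℤ.+ m)
  identity = solve-∀

twoD≡ : ∀ p q → twoD p q ≡ + 2 ℤ.* + q ℤ.- (+ p ℤ.* + p ℤ.- + p)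
twoD≡ p q = cong₂ ℤ._-_ (pos-* 2 q) (p*[p∸1]≡p*p-p p)

-- the quantity t of LeB: x ≤ B(p, q, a) iff excess a p x ≤ √(radicand a p q)
excess : ℕ → ℕ → ℕ → ℤ.ℤ
excess a p x = + 2 ℤ.* + x ℤ.- hVal a p

twoD-step : ∀ p q a x
          → twoD (p + x) (q + a * x) ≡ twoD p q ℤ.+ + x ℤ.* + x ℤ.+ + x ℤ.* ℤ.- excess a p x
twoD-step p q a x = begin
  twoD (p + x) (q + a * x)
    ≡⟨ twoD≡ (p + x) (q + a * x) ⟩
  + 2 ℤ.* + (q + a * x) ℤ.- (+ (p + x) ℤ.* + (p + x) ℤ.- + (p + x))
    ≡⟨ cong₂ (λ q′ p′ → + 2 ℤ.* q′ ℤ.- (p′ ℤ.* p′ ℤ.- p′))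
             (trans (pos-+ q (a * x)) (cong (ℤ._+_ (+ q)) (pos-* a x))) (pos-+ p x) ⟩
  + 2 ℤ.* (+ q ℤ.+ + a ℤ.* + x) ℤ.- ((+ p ℤ.+ + x) ℤ.* (+ p ℤ.+ + x) ℤ.- (+ p ℤ.+ + x))
    ≡⟨ identity (+ p) (+ q) (+ x) (+ a) ⟩
  + 2 ℤ.* + q ℤ.- (+ p ℤ.* + p ℤ.- + p) ℤ.+ + x ℤ.* + x ℤ.+ + x ℤ.* ℤ.- excess a p x
    ≡⟨ cong (λ d → d ℤ.+ + x ℤ.* + x ℤ.+ + x ℤ.* ℤ.- excess a p x) (sym (twoD≡ p q)) ⟩
  twoD p q ℤ.+ + x ℤ.* + x ℤ.+ + x ℤ.* ℤ.- excess a p x ∎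
  where
  open ≡-Reasoning
  identity : ∀ p q x a
           → + 2 ℤ.* (q ℤ.+ a ℤ.* x) ℤ.- ((p ℤ.+ x) ℤ.* (p ℤ.+ x) ℤ.- (p ℤ.+ x))
           ≡ + 2 ℤ.* q ℤ.- (p ℤ.* p ℤ.- p) ℤ.+ x ℤ.* x
             ℤ.+ x ℤ.* ℤ.- (+ 2 ℤ.* x ℤ.- (+ 2 ℤ.* (a ℤ.- p) ℤ.+ + 1))
  identity = solve-∀

radicand-step : ∀ p q a x
              → radicand a p q ℤ.- excess a p x ℤ.* excess a p x ≡ + 4 ℤ.* twoD (p + x) (q + a * x)
radicand-step p q a x rewrite twoD-step p q a x = identity (hVal a p) (twoD p q) (+ x)
  where
  identity : ∀ h d x
           → h ℤ.* h ℤ.+ + 4 ℤ.* d ℤ.- (+ 2 ℤ.* x ℤ.- h) ℤ.* (+ 2 ℤ.* x ℤ.- h)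
           ≡ + 4 ℤ.* (d ℤ.+ x ℤ.* x ℤ.+ x ℤ.* ℤ.- (+ 2 ℤ.* x ℤ.- h))
  identity = solve-∀

0≤i*j : ∀ {i j} → 0ℤ ℤ.≤ i → 0ℤ ℤ.≤ j → 0ℤ ℤ.≤ i ℤ.* j
0≤i*j {+ m} {+ n} _ _ = subst (0ℤ ℤ.≤_) (pos-* m n) (+≤+ z≤n)

0≤4*i⇒0≤i : ∀ i → 0ℤ ℤ.≤ + 4 ℤ.* i → 0ℤ ℤ.≤ i
0≤4*i⇒0≤i (+ n)    _  = +≤+ z≤n
0≤4*i⇒0≤i -[1+ n ] ()

twoD-nonNeg-step : ∀ p q a x → 0ℤ ℤ.≤ twoD p q → LeB p q a x → 0ℤ ℤ.≤ twoD (p + x) (q + a * x)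
twoD-nonNeg-step p q a x 0≤d (_ , inj₁ e≤0) =
  subst (0ℤ ℤ.≤_) (sym (twoD-step p q a x))
    (+-mono-≤ℤ (+-mono-≤ℤ 0≤d (0≤i*j {+ x} (+≤+ z≤n) (+≤+ z≤n))) (0≤i*j {+ x} (+≤+ z≤n) (neg-mono-≤ e≤0)))
twoD-nonNeg-step p q a x _ (_ , inj₂ e²≤r) =
  0≤4*i⇒0≤i _ (subst (0ℤ ℤ.≤_) (radicand-step p q a x) (i≤j⇒0≤j-i e²≤r))

0≤twoD⇒p*[p∸1]≤2*q : ∀ p q → 0ℤ ℤ.≤ twoD p q → p * (p ∸ 1) ≤ 2 * q
0≤twoD⇒p*[p∸1]≤2*q p q 0≤d = drop‿+≤+ (0≤i-j⇒j≤i 0≤d)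

p*[p∸1]≤p*[2*b]⇒p≤2*b+1 : ∀ p b → p * (p ∸ 1) ≤ p * (2 * b) → p ≤ 2 * b + 1
p*[p∸1]≤p*[2*b]⇒p≤2*b+1 zero    b _ = z≤n
p*[p∸1]≤p*[2*b]⇒p≤2*b+1 (suc m) b h = subst (suc m ≤_) (+-comm 1 (2 * b)) (s≤s (*-cancelˡ-≤ (suc m) h))

Q≤a*P : ∀ (a x : ℕ → ℕ) k → (∀ j → j < k → a j ≤ a (suc j)) → Q a x k ≤ a k * P x k
Q≤a*P a x zero    _    = z≤n
Q≤a*P a x (suc k) mono = begin
  Q a x k + a (suc k) * x (suc k)
    ≤⟨ +-monoˡ-≤ (a (suc k) * x (suc k)) (begin
         Q a x k           ≤⟨ Q≤a*P a x k (λ j j<k → mono j (m<n⇒m<1+n j<k)) ⟩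
         a k * P x k       ≤⟨ *-monoˡ-≤ (P x k) (mono k (n<1+n k)) ⟩
         a (suc k) * P x k ∎) ⟩
  a (suc k) * P x k + a (suc k) * x (suc k)
    ≡⟨ sym (*-distribˡ-+ (a (suc k)) (P x k) (x (suc k))) ⟩
  a (suc k) * P x (suc k) ∎
  where open ≤-Reasoning

AgreeUpTo : ℕ → (ℕ → ℕ) → (ℕ → ℕ) → Set
AgreeUpTo k x y = ∀ i → i ≤ k → x i ≡ y i

AgreeUpTo-≤ : ∀ {j k x y} → j ≤ k → AgreeUpTo k x y → AgreeUpTo j x y
AgreeUpTo-≤ j≤k x≈y i i≤j = x≈y i (≤-trans i≤j j≤k)

P-cong : ∀ {x y} k → AgreeUpTo k x y → P x k ≡ P y k
P-cong zero    _   = refl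
P-cong (suc k) x≈y = cong₂ _+_ (P-cong k (AgreeUpTo-≤ (n≤1+n k) x≈y)) (x≈y (suc k) ≤-refl)

Q-cong : ∀ a {x y} k → AgreeUpTo k x y → Q a x k ≡ Q a y k
Q-cong a zero    _   = refl
Q-cong a (suc k) x≈y =
  cong₂ _+_ (Q-cong a k (AgreeUpTo-≤ (n≤1+n k) x≈y)) (cong (a (suc k) *_) (x≈y (suc k) ≤-refl))

extend : (ℕ → ℕ) → ℕ → ℕ → ℕ → ℕ
extend x j x′ i with i ≤? j
... | yes _ = x i
... | no  _ = x′

extend-agrees : ∀ x j x′ → AgreeUpTo j x (extend x j x′)
extend-agrees x j x′ i i≤j with i ≤? j
... | yes _   = refl
... | no  i≰j = contradiction i≤j i≰j

extend-suc : ∀ x j x′ → extend x j x′ (suc j) ≡ x′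
extend-suc x j x′ with suc j ≤? j
... | yes j<j = contradiction j<j (n≮n j)
... | no  _   = refl

module _ (a : ℕ → ℕ) where

  Admissible : (ℕ → ℕ) → ℕ → Set
  Admissible x j =
    0ℤ ℤ.≤ twoD (P x j) (Q a x j) × 1 ≤ x (suc j) × LeB (P x j) (Q a x j) (a (suc j)) (x (suc j))

  Reconstructs : ℕ → ℕ → ℕ → (ℕ → ℕ) → Set
  Reconstructs k p q x = P x k ≡ p × Q a x k ≡ q × (∀ j → j < k → Admissible x j)

  admissible : ∀ {x j p q x′} → P x j ≡ p → Q a x j ≡ q → x (suc j) ≡ x′
             → 0ℤ ℤ.≤ twoD p q → 1 ≤ x′ → LeB p q (a (suc j)) x′ → Admissible x j
  admissible refl refl refl 0≤d 1≤x′ lb = 0≤d , 1≤x′ , lb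

  Admissible-cong : ∀ {x y j} → AgreeUpTo (suc j) x y → Admissible x j → Admissible y j
  Admissible-cong {x} {y} {j} x≈y (0≤d , 1≤x , lb) =
    admissible (sym (P-cong j x≈y′)) (sym (Q-cong a j x≈y′)) (sym (x≈y (suc j) ≤-refl)) 0≤d 1≤x lb
    where
    x≈y′ : AgreeUpTo j x y
    x≈y′ = AgreeUpTo-≤ (n≤1+n j) x≈y

  reconstructs⇒twoD-nonNeg : ∀ {k p q x} → Reconstructs k p q x → 0ℤ ℤ.≤ twoD p q
  reconstructs⇒twoD-nonNeg {zero}  (refl , refl , _)   = +≤+ z≤n
  reconstructs⇒twoD-nonNeg {suc j} {x = x} (refl , refl , adm) =
    let 0≤d , _ , lb = adm j (n<1+n j)
    in  twoD-nonNeg-step (P x j) (Q a x j) (a (suc j)) (x (suc j)) 0≤d lb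

  reconstructs-init : ∀ {j p q x} → Reconstructs (suc j) p q x → Reconstructs j (P x j) (Q a x j) x
  reconstructs-init (_ , _ , adm) = refl , refl , λ i i<j → adm i (m<n⇒m<1+n i<j)

  reconstructs-snoc : ∀ {j p q x x′} → Reconstructs j p q x → 1 ≤ x′ → LeB p q (a (suc j)) x′
                    → Reconstructs (suc j) (p + x′) (q + a (suc j) * x′) (extend x j x′)
  reconstructs-snoc {j} {x = x} {x′} r@(refl , refl , adm) 1≤x′ lb =
      cong₂ _+_ (sym (P-cong j agree)) (extend-suc x j x′)
    , cong₂ _+_ (sym (Q-cong a j agree)) (cong (a (suc j) *_) (extend-suc x j x′))
    , adm′
    where
    agree : AgreeUpTo j x (extend x j x′)
    agree = extend-agrees x j x′
    adm′ : ∀ i → i < suc j → Admissible (extend x j x′) i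
    adm′ i i<1+j with m<1+n⇒m<n∨m≡n i<1+j
    ... | inj₁ i<j  = Admissible-cong (AgreeUpTo-≤ i<j agree) (adm i i<j)
    ... | inj₂ refl = admissible (sym (P-cong j agree)) (sym (Q-cong a j agree)) (extend-suc x j x′)
                        (reconstructs⇒twoD-nonNeg r) 1≤x′ lb

  reconstructs⇒bounded : ∀ {k p q x} → (∀ j → j < k → a j ≤ a (suc j)) → Reconstructs k p q x
                       → p ≤ 2 * a k + 1 × q ≤ (2 * a k + 1) * a k
  reconstructs⇒bounded {k} {x = x} mono r@(refl , refl , _) = P≤ , Q≤
    where
    open ≤-Reasoning
    P≤ : P x k ≤ 2 * a k + 1
    P≤ = p*[p∸1]≤p*[2*b]⇒p≤2*b+1 (P x k) (a k) (begin
      P x k * (P x k ∸ 1) ≤⟨ 0≤twoD⇒p*[p∸1]≤2*q (P x k) (Q a x k) (reconstructs⇒twoD-nonNeg r) ⟩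
      2 * Q a x k         ≤⟨ *-monoʳ-≤ 2 (Q≤a*P a x k mono) ⟩
      2 * (a k * P x k)   ≡⟨ sym (*-assoc 2 (a k) (P x k)) ⟩
      2 * a k * P x k     ≡⟨ *-comm (2 * a k) (P x k) ⟩
      P x k * (2 * a k)   ∎)
    Q≤ : Q a x k ≤ (2 * a k + 1) * a k
    Q≤ = begin
      Q a x k             ≤⟨ Q≤a*P a x k mono ⟩
      a k * P x k         ≤⟨ *-monoʳ-≤ (a k) P≤ ⟩
      a k * (2 * a k + 1) ≡⟨ *-comm (a k) (2 * a k + 1) ⟩
      (2 * a k + 1) * a k ∎

αAt-suc : ∀ {n} (α : Fin n → ℕ) {m} (m<n : m < n) → αAt n α (suc m) ≡ α (fromℕ< m<n)
αAt-suc {n} α {m} m<n with m <? n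
... | yes _   = refl
... | no  m≮n = contradiction m<n m≮n

αAt-nondecreasing : ∀ {n} (α : Fin n → ℕ) → (∀ (i j : Fin n) → i Data.Fin.< j → α i < α j)
                  → ∀ j → j < n → αAt n α j ≤ αAt n α (suc j)
αAt-nondecreasing α increasing zero    _     = z≤n
αAt-nondecreasing {n} α increasing (suc m) 1+m<n = begin
  αAt n α (suc m)        ≡⟨ αAt-suc α m<n ⟩
  α (fromℕ< m<n)         ≤⟨ <⇒≤ (increasing _ _ fromℕ<-<) ⟩
  α (fromℕ< 1+m<n)       ≡⟨ sym (αAt-suc α 1+m<n) ⟩
  αAt n α (suc (suc m))  ∎
  where
  open ≤-Reasoning
  m<n : m < n
  m<n = <⇒≤ 1+m<n
  fromℕ<-< : fromℕ< m<n Data.Fin.< fromℕ< 1+m<n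
  fromℕ<-< = subst₂ _<_ (sym (toℕ-fromℕ< m<n)) (sym (toℕ-fromℕ< 1+m<n)) (n<1+n m)

module Correspondence (n : ℕ) (α : Fin n → ℕ)
                      (nondecreasing : ∀ j → j < n → αAt n α j ≤ αAt n α (suc j)) where

  A : ℕ → ℕ
  A = αAt n α

  nondecreasing-below : ∀ {k} → k < n → ∀ j → j < k → A j ≤ A (suc j)
  nondecreasing-below k<n j j<k = nondecreasing j (<-trans j<k k<n)

  occupied⇒reconstructible : ∀ k → k < n → ∀ {p q} → Occupied (L n α k) p q → ∃ (Reconstructs A k p q)
  occupied⇒reconstructible zero _ {zero}  {zero}  _   = (λ _ → 0) , refl , refl , λ _ ()
  occupied⇒reconstructible zero _ {zero}  {suc _} occ = contradiction refl occ
  occupied⇒reconstructible zero _ {suc _}         occ = contradiction refl occ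
  occupied⇒reconstructible (suc j) 1+j<n occ with iteration⁻ (A j) (A (suc j)) (L n α j) occ
  ... | p′ , q′ , x′ , 1≤x′ , occ′ , lb , refl , refl
    with occupied⇒reconstructible j (<⇒≤ 1+j<n) occ′
  ... | x , r =
    extend x j x′ ,
    subst (λ q → Reconstructs A (suc j) (p′ + x′) q (extend x j x′))
          (cong (_+_ q′) (*-comm (A (suc j)) x′)) (reconstructs-snoc A r 1≤x′ lb)

  reconstructible⇒occupied : ∀ k → k < n → ∀ {p q} → ∃ (Reconstructs A k p q) → Occupied (L n α k) p q
  reconstructible⇒occupied zero    _     (_ , refl , refl , _) = λ ()
  reconstructible⇒occupied (suc j) 1+j<n (x , r@(refl , refl , adm)) with adm j (n<1+n j)
  ... | _ , 1≤x′ , lb =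
    subst (Occupied (L n α (suc j)) (P x (suc j))) (cong (_+_ (Q A x j)) (*-comm (x (suc j)) (A (suc j))))
      (iteration-occupies (A j) (A (suc j)) (L n α j) 1≤x′ x′≤ (proj₁ bounds) (proj₂ bounds)
        (reconstructible⇒occupied j j<n (x , r′)) lb)
    where
    j<n : j < n
    j<n = <⇒≤ 1+j<n
    r′ : Reconstructs A j (P x j) (Q A x j) x
    r′ = reconstructs-init A r
    bounds : P x j ≤ 2 * A j + 1 × Q A x j ≤ (2 * A j + 1) * A j
    bounds = reconstructs⇒bounded A (nondecreasing-below j<n) r′
    x′≤ : x (suc j) ≤ 2 * A (suc j) + 1
    x′≤ = ≤-trans (m≤n+m (x (suc j)) (P x j)) (proj₁ (reconstructs⇒bounded A (nondecreasing-below 1+j<n) r))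

lemma3p5 : (n : ℕ) → 2 ≤ n → (α : Fin n → ℕ)
    → (∀ (i j : Fin n) → i Data.Fin.< j → α i < α j)
    → (k : ℕ) → 1 ≤ k → k < n
    → (p q : ℕ) → p ≤ 2 * αAt n α k + 1 → q ≤ (2 * αAt n α k + 1) * αAt n α k
    → (L n α k p q ≢ [])
      ⇔ Σ (ℕ → ℕ) (λ x →
          (P x k ≡ p) × (Q (αAt n α) x k ≡ q)
          × (∀ j → j < k →
               ((+ 0) ℤ.≤ twoD (P x j) (Q (αAt n α) x j))
               × (1 ≤ x (suc j))
               × LeB (P x j) (Q (αAt n α) x j) (αAt n α (suc j)) (x (suc j))))
-- The equivalence holds for every cell (p, q) and every k < n.
lemma3p5 n _ α increasing k _ k<n p q _ _ =
  mk⇔ (occupied⇒reconstructible k k<n) (reconstructible⇒occupied k k<n)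
  where open Correspondence n α (αAt-nondecreasing α increasing)
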